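{- Let $n\ge0$ and $\mathscr E_n=\mathscr E_{\{0,1,\dots,n-1\}}$. The rank of the top element of $\mathscr E_n$ is $1+n(n+1)/2$; hence $\mathscr E_n$ has height $2+n(n+1)/2$.
   Context: For a finite totally ordered set $O$, an interval of $O$ is a set of consecutive elements (the empty set included). $\mathscr E_O$ is the set of antichains with respect to inclusion of intervals of $O$, ordered by $A\le B$ iff for every $I\in A$ there is $J\in B$ with $J\subseteq I$; it is a finite distributive lattice with bottom $\emptyset$ and top $\{\emptyset\}$. The rank function $\mathfrak r$ satisfies $\mathfrak r(0)=0$ and $\mathfrak r(x)=\mathfrak r(y)+1$ whenever $x$ covers $y$. The height of the lattice is the number of elements in a longest chain. -}

module Defs where

open import Data.Nat using (ℕ; suc; _*_; _≤_)
open import Data.Nat.DivMod using (_/_)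
open import Data.Fin using (Fin) renaming (_≤_ to _≤ᶠ_)
open import Data.Fin.Subset using (Subset; _∈_; _⊆_) renaming (⊥ to ∅)
open import Data.List using (List; []; _∷_; length)
open import Data.List.Relation.Unary.All using (All)
open import Data.List.Relation.Unary.AllPairs using (AllPairs)
import Data.List.Membership.Propositional as LM
open import Data.Product using (Σ; _×_; ∃)
open import Data.Sum using (_⊎_)
open import Relation.Nullary using (¬_)
open import Relation.Binary.PropositionalEquality using (_≡_)

IsInterval : {n : ℕ} → Subset n → Set
IsInterval {n} S = ∀ {i j k : Fin n} → i ≤ᶠ j → j ≤ᶠ k → i ∈ S → k ∈ S → j ∈ S

-- An element of 𝓔_n: a finite set of intervals, given as a list, whose
-- members are pairwise incomparable for inclusion (in particular distinct).
record Antichain (n : ℕ) : Set where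
  constructor mkAntichain
  field
    elems     : List (Subset n)
    intervals : All IsInterval elems
    antichain : AllPairs (λ I J → ¬ (I ⊆ J) × ¬ (J ⊆ I)) elems
open Antichain public

_≈_ : {n : ℕ} → Antichain n → Antichain n → Set
A ≈ B = ∀ I → (I LM.∈ elems A → I LM.∈ elems B) × (I LM.∈ elems B → I LM.∈ elems A)

_≼_ : {n : ℕ} → Antichain n → Antichain n → Set
A ≼ B = ∀ I → I LM.∈ elems A → ∃ λ J → J LM.∈ elems B × J ⊆ I

_≺_ : {n : ℕ} → Antichain n → Antichain n → Set
A ≺ B = A ≼ B × ¬ (A ≈ B)

Covers : {n : ℕ} → Antichain n → Antichain n → Set
Covers x y = y ≺ x × (∀ z → ¬ (y ≺ z × z ≺ x))

bot : (n : ℕ) → Antichain n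
bot n = mkAntichain [] All.[] AllPairs.[]

top : (n : ℕ) → Antichain n
top n = mkAntichain (∅ ∷ []) (ivl All.∷ All.[]) (All.[] AllPairs.∷ AllPairs.[])
  where
  open import Data.Fin.Subset.Properties using (∉⊥)
  ivl : IsInterval {n} ∅
  ivl _ _ i∈ _ = Data.Empty.⊥-elim (∉⊥ i∈)
    where import Data.Empty

IsRank : {n : ℕ} → (Antichain n → ℕ) → Set
IsRank {n} r = (r (bot n) ≡ 0) × (∀ x y → Covers x y → r x ≡ suc (r y))

IsChain : {n : ℕ} → List (Antichain n) → Set
IsChain = AllPairs (λ A B → ¬ (A ≈ B) × (A ≼ B ⊎ B ≼ A))

HasHeight : (n : ℕ) → ℕ → Set
HasHeight n h = (Σ (List (Antichain n)) λ c → IsChain c × length c ≡ h)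
              × (∀ (c : List (Antichain n)) → IsChain c → length c ≤ h)

tri : ℕ → ℕ
tri n = (n * suc n) / 2

-- Antichains of intervals are determined by the up-sets they generate in the
-- poset of intervals, and A ≼ B is inclusion of these up-sets.  Hence
-- ρ A, the number of intervals lying above some member of A, is strictly
-- monotone.  If y ≼ x and ρ x ≥ ρ y + 2, adjoining to y an inclusion-maximal
-- interval lying above x but not above y yields an antichain strictly in
-- between whose up-set has exactly one new interval; so x covers y iff ρ x = ρ y + 1, and ρ
-- is a rank function.  A saturated chain from ∅ to {∅} then shows that every
-- rank function takes the value ρ {∅} = #intervals = 1 + n(n+1)/2 at the top,
-- and gives a chain with 2 + n(n+1)/2 elements; no chain is longer since ρ is
-- injective on chains with values in [0, 1 + n(n+1)/2].

module Submission where

open import Level using (Level; 0ℓ)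
open import Data.Bool using (Bool; true; false; T; T?)
open import Data.Empty using (⊥-elim)
open import Data.Fin using (Fin; zero; suc) renaming (_≤_ to _≤ᶠ_)
open import Data.Fin.Subset using (Subset; outside; inside; _⊆_; _⊂_; _⊄_; Empty; ∣_∣)
  renaming (_∈_ to _∈ₛ_; ⊥ to ∅)
open import Data.Fin.Subset.Properties
  using (_∈?_; _⊆?_; _⊂?_; drop-there; ⊆-refl; ⊆-trans; ⊆-antisym; ⊆-min; p⊂q⇒∣p∣<∣q∣)
open import Data.List using (List; []; _∷_; _++_; map; filter; length)
open import Data.List.Extrema.Nat using (argmax; argmax-all; f[xs]≤f[argmax])
open import Data.List.Membership.Propositional using (_∈_; find; lose)
open import Data.List.Membership.Propositional.Properties
  using (∈-map⁺; ∈-map⁻; ∈-++⁺ˡ; ∈-++⁺ʳ; ∈-filter⁺; ∈-filter⁻)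
open import Data.List.Properties using (filter-≐; filter-++; filter-none; filter-all; length-++; length-map)
open import Data.List.Relation.Unary.All as All using (All; []; _∷_)
import Data.List.Relation.Unary.All.Properties as All
open import Data.List.Relation.Unary.AllPairs as AllPairs using (AllPairs; []; _∷_)
import Data.List.Relation.Unary.AllPairs.Properties as AllPairs
open import Data.List.Relation.Unary.Any using (Any; here; there; any?)
open import Data.List.Relation.Unary.Unique.Propositional using (Unique)
import Data.List.Relation.Unary.Unique.Propositional.Properties as Unique
open import Data.Nat using (ℕ; zero; suc; _+_; _*_; _≤_; _<_; z≤n; s≤s)
open import Data.Nat.Divisibility using (divides-refl)
open import Data.Nat.DivMod using (_/_; +-distrib-/-∣ʳ; m*n/n≡m)
open import Data.Nat.Properties
  using (_≟_; ≤-antisym; ≤-trans; ≤-reflexive; ≤-pred; m≤n⇒m≤1+n; m≤n+m; ≤∧≢⇒<; ≮⇒≥; <⇒≱; <⇒≢; >⇒≢;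
         <-trans; n<1+n; +-suc; +-identityʳ; module ≤-Reasoning)
open import Data.Nat.Tactic.RingSolver using (solve-∀)
open import Data.Product using (Σ; ∃; _×_; _,_; proj₁; proj₂)
open import Data.Sum using (_⊎_; inj₁; inj₂; [_,_]; swap)
open import Data.Vec using ([]; _∷_; here; there)
open import Function using (_∘_; id)
open import Relation.Nullary using (¬_; yes; no; does; ¬?; contradiction)
open import Relation.Nullary.Decidable using (map′; toSum; _×-dec_; decidable-stable)
open import Relation.Unary using (Pred; Decidable; _≐_; ∁)
open import Relation.Unary.Properties using (U?)
open import Relation.Binary.PropositionalEquality
  using (_≡_; _≢_; refl; sym; trans; cong; cong₂; subst; module ≡-Reasoning)

open import Defs

private
  variable
    a p q : Level
    A B : Set a
    xs : List A
    y : A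

count : {P : Pred A p} → Decidable P → List A → ℕ
count P? xs = length (filter P? xs)

module _ {P : Pred A p} (P? : Decidable P) where

  count-++ : ∀ xs ys → count P? (xs ++ ys) ≡ count P? xs + count P? ys
  count-++ xs ys = trans (cong length (filter-++ P? xs ys)) (length-++ (filter P? xs))

  count-map : (f : B → A) (xs : List B) → count P? (map f xs) ≡ count (P? ∘ f) xs
  count-map f [] = refl
  count-map f (x ∷ xs) with does (P? (f x))
  ... | true  = cong suc (count-map f xs)
  ... | false = count-map f xs

  count-none : ∀ xs → All (∁ P) xs → count P? xs ≡ 0
  count-none xs none = cong length (filter-none P? none)

  count-all : ∀ xs → All P xs → count P? xs ≡ length xs
  count-all xs all = cong length (filter-all P? all)

module _ {P : Pred A p} {Q : Pred A q} (P? : Decidable P) (Q? : Decidable Q) where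

  count-cong : P ≐ Q → ∀ xs → count P? xs ≡ count Q? xs
  count-cong P≐Q xs = cong length (filter-≐ P? Q? P≐Q xs)

  count-mono : (∀ {x} → x ∈ xs → P x → Q x) → count P? xs ≤ count Q? xs
  count-mono {[]}     _ = z≤n
  count-mono {x ∷ xs} P⇒Q with P? x | Q? x
  ... | yes px | yes _  = s≤s (count-mono (P⇒Q ∘ there))
  ... | yes px | no ¬qx = contradiction (P⇒Q (here refl) px) ¬qx
  ... | no _   | yes _  = m≤n⇒m≤1+n (count-mono (P⇒Q ∘ there))
  ... | no _   | no _   = count-mono (P⇒Q ∘ there)

  count-mono-< : (∀ {x} → x ∈ xs → P x → Q x) → y ∈ xs → Q y → ¬ P y → count P? xs < count Q? xs
  count-mono-< {x ∷ xs} P⇒Q (here refl) qx ¬px with P? x | Q? x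
  ... | yes px | _      = contradiction px ¬px
  ... | no _   | yes _  = s≤s (count-mono (P⇒Q ∘ there))
  ... | no _   | no ¬qx = contradiction qx ¬qx
  count-mono-< {x ∷ xs} P⇒Q (there y∈) qy ¬py with P? x | Q? x
  ... | yes px | yes _  = s≤s (count-mono-< (P⇒Q ∘ there) y∈ qy ¬py)
  ... | yes px | no ¬qx = contradiction (P⇒Q (here refl) px) ¬qx
  ... | no _   | yes _  = m≤n⇒m≤1+n (count-mono-< (P⇒Q ∘ there) y∈ qy ¬py)
  ... | no _   | no _   = count-mono-< (P⇒Q ∘ there) y∈ qy ¬py

  count-≤-suc : Unique xs → (∀ {x} → x ∈ xs → P x → Q x ⊎ x ≡ y) →
                count P? xs ≤ suc (count Q? xs)
  count-≤-suc {[]}     _            _ = z≤n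
  count-≤-suc {x ∷ xs} (x∉xs ∷ uxs) h with P? x | Q? x
  ... | no _   | no _  = count-≤-suc uxs (h ∘ there)
  ... | no _   | yes _ = m≤n⇒m≤1+n (count-≤-suc uxs (h ∘ there))
  ... | yes _  | yes _ = s≤s (count-≤-suc uxs (h ∘ there))
  ... | yes px | no ¬qx with h (here refl) px
  ...   | inj₁ qx   = contradiction qx ¬qx
  ...   | inj₂ refl = s≤s (count-mono λ z∈ pz → [ id , (λ z≡x → contradiction (sym z≡x) (All.lookup x∉xs z∈)) ]
                                                   (h (there z∈) pz))

unique-<⇒length≤ : ∀ N {ns : List ℕ} → Unique ns → All (_< N) ns → length ns ≤ N
unique-<⇒length≤ zero    {[]}    _ _        = z≤n
unique-<⇒length≤ zero    {_ ∷ _} _ (() ∷ _)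
unique-<⇒length≤ (suc N) {ns}    u all<sucN = begin
  length ns                    ≡⟨ count-all U? ns (All.tabulate _) ⟨
  count U? ns                  ≤⟨ count-≤-suc U? ≢N? u (λ {v} _ _ → swap (toSum (v ≟ N))) ⟩
  suc (count ≢N? ns)           ≤⟨ s≤s (unique-<⇒length≤ N (Unique.filter⁺ ≢N? u) (All.tabulate all<N)) ⟩
  suc N                        ∎
  where
  open ≤-Reasoning
  ≢N? : Decidable (_≢ N)
  ≢N? v = ¬? (v ≟ N)
  all<N : ∀ {v} → v ∈ filter ≢N? ns → v < N
  all<N v∈ = let v∈ns , v≢N = ∈-filter⁻ ≢N? v∈ in ≤∧≢⇒< (≤-pred (All.lookup all<sucN v∈ns)) v≢N

subsets : ∀ n → List (Subset n)
subsets zero    = [] ∷ []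
subsets (suc n) = map (outside ∷_) (subsets n) ++ map (inside ∷_) (subsets n)

∈-subsets : ∀ {n} (S : Subset n) → S ∈ subsets n
∈-subsets []            = here refl
∈-subsets (outside ∷ S) = ∈-++⁺ˡ (∈-map⁺ (outside ∷_) (∈-subsets S))
∈-subsets {suc n} (inside ∷ S) = ∈-++⁺ʳ (map (outside ∷_) (subsets n)) (∈-map⁺ (inside ∷_) (∈-subsets S))

subsets-unique : ∀ n → Unique (subsets n)
subsets-unique zero    = [] ∷ []
subsets-unique (suc n) =
  Unique.++⁺ (Unique.map⁺ ∷-injective (subsets-unique n)) (Unique.map⁺ ∷-injective (subsets-unique n)) disjoint
  where
  ∷-injective : ∀ {b} {S T : Subset n} → _≡_ {A = Subset (suc n)} (b ∷ S) (b ∷ T) → S ≡ T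
  ∷-injective refl = refl
  disjoint : ∀ {S} → ¬ (S ∈ map (outside ∷_) (subsets n) × S ∈ map (inside ∷_) (subsets n))
  disjoint (S∈out , S∈in) with ∈-map⁻ (outside ∷_) S∈out | ∈-map⁻ (inside ∷_) S∈in
  ... | _ , _ , refl | _ , _ , ()

∃-⊂-maximal : ∀ {n p} {P : Pred (Subset n) p} {I₀} → Decidable P → P I₀ →
  ∃ λ M → P M × (∀ {I} → M ⊂ I → ¬ P I)
∃-⊂-maximal {n} {P = P} {I₀} P? PI₀ =
  argmax ∣_∣ I₀ candidates , argmax-all ∣_∣ PI₀ (All.all-filter P? (subsets n)) , maximal
  where
  candidates : List (Subset n)
  candidates = filter P? (subsets n)
  maximal : ∀ {I} → argmax ∣_∣ I₀ candidates ⊂ I → ¬ P I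
  maximal {I} M⊂I PI = <⇒≱ (p⊂q⇒∣p∣<∣q∣ M⊂I)
    (All.lookup (f[xs]≤f[argmax] I₀ candidates) (∈-filter⁺ P? (∈-subsets I) PI))

⊆∧⊄⇒⊇ : ∀ {n} {S T : Subset n} → S ⊆ T → S ⊄ T → T ⊆ S
⊆∧⊄⇒⊇ {S = S} S⊆T S⊄T {x} x∈T with x ∈? S
... | yes x∈S = x∈S
... | no  x∉S = contradiction ((λ {y} → S⊆T {y}) , x , x∈T , x∉S) S⊄T

IsInitial : ∀ {n} → Subset n → Set
IsInitial {n} S = ∀ {i j : Fin n} → i ≤ᶠ j → j ∈ₛ S → i ∈ₛ S

-- Decoding a subset from its first bit: an interval not containing 0 is an
-- interval of the tail, and one containing 0 is 0 followed by an initial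
-- segment of the tail; hence the recurrence behind count-intervalᵇ.
emptyᵇ initialᵇ intervalᵇ : ∀ {n} → Subset n → Bool
emptyᵇ []            = true
emptyᵇ (inside  ∷ S) = false
emptyᵇ (outside ∷ S) = emptyᵇ S
initialᵇ []            = true
initialᵇ (inside  ∷ S) = initialᵇ S
initialᵇ (outside ∷ S) = emptyᵇ S
intervalᵇ []            = true
intervalᵇ (inside  ∷ S) = initialᵇ S
intervalᵇ (outside ∷ S) = intervalᵇ S

emptyᵇ-sound : ∀ {n} (S : Subset n) → T (emptyᵇ S) → Empty S
emptyᵇ-sound (outside ∷ S) e (suc j , there j∈S) = emptyᵇ-sound S e (j , j∈S)

emptyᵇ-complete : ∀ {n} (S : Subset n) → Empty S → T (emptyᵇ S)
emptyᵇ-complete []            _ = _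
emptyᵇ-complete (inside  ∷ S) e = e (zero , here)
emptyᵇ-complete (outside ∷ S) e = emptyᵇ-complete S (λ (j , j∈S) → e (suc j , there j∈S))

initialᵇ-sound : ∀ {n} (S : Subset n) → T (initialᵇ S) → IsInitial S
initialᵇ-sound (inside  ∷ S) e {zero}          _         _           = here
initialᵇ-sound (inside  ∷ S) e {suc i} {suc j} (s≤s i≤j) (there j∈S) = there (initialᵇ-sound S e i≤j j∈S)
initialᵇ-sound (outside ∷ S) e {j = suc j}     _         (there j∈S) = contradiction (j , j∈S) (emptyᵇ-sound S e)

initialᵇ-complete : ∀ {n} (S : Subset n) → IsInitial S → T (initialᵇ S)
initialᵇ-complete []            _    = _
initialᵇ-complete (inside  ∷ S) init =
  initialᵇ-complete S λ i≤j j∈S → drop-there (init (s≤s i≤j) (there j∈S))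
initialᵇ-complete (outside ∷ S) init =
  emptyᵇ-complete S λ (j , j∈S) → zero∉ (init {zero} {suc j} z≤n (there j∈S))
  where
  zero∉ : ¬ zero ∈ₛ (outside ∷ S)
  zero∉ ()

intervalᵇ-sound : ∀ {n} (S : Subset n) → T (intervalᵇ S) → IsInterval S
intervalᵇ-sound (inside  ∷ S) e {j = zero}  _ _ _ _ = here
intervalᵇ-sound (inside  ∷ S) e {j = suc j} {suc k} _ (s≤s j≤k) _ (there k∈S) =
  there (initialᵇ-sound S e j≤k k∈S)
intervalᵇ-sound (outside ∷ S) e {suc i} {suc j} {suc k} (s≤s i≤j) (s≤s j≤k) (there i∈S) (there k∈S) =
  there (intervalᵇ-sound S e i≤j j≤k i∈S k∈S)

intervalᵇ-complete : ∀ {n} (S : Subset n) → IsInterval S → T (intervalᵇ S)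
intervalᵇ-complete []            _   = _
intervalᵇ-complete (inside  ∷ S) ivl = initialᵇ-complete S λ {i} {j} i≤j j∈S →
  drop-there (ivl {zero} {suc i} {suc j} z≤n (s≤s i≤j) here (there j∈S))
intervalᵇ-complete (outside ∷ S) ivl = intervalᵇ-complete S λ i≤j j≤k i∈S k∈S →
  drop-there (ivl (s≤s i≤j) (s≤s j≤k) (there i∈S) (there k∈S))

isInterval? : ∀ {n} → Decidable (IsInterval {n})
isInterval? S = map′ (intervalᵇ-sound S) (intervalᵇ-complete S) (T? (intervalᵇ S))

tri-suc : ∀ n → tri (suc n) ≡ tri n + suc n
tri-suc n = begin
  suc n * suc (suc n) / 2        ≡⟨ cong (_/ 2) (expand n) ⟩
  (n * suc n + suc n * 2) / 2    ≡⟨ +-distrib-/-∣ʳ (n * suc n) (divides-refl (suc n)) ⟩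
  n * suc n / 2 + suc n * 2 / 2  ≡⟨ cong (tri n +_) (m*n/n≡m (suc n) 2) ⟩
  tri n + suc n                  ∎
  where
  open ≡-Reasoning
  expand : ∀ n → suc n * suc (suc n) ≡ n * suc n + suc n * 2
  expand = solve-∀

count-subsets-suc : ∀ n {p} {P : Pred (Subset (suc n)) p} (P? : Decidable P) →
  count P? (subsets (suc n))
    ≡ count (P? ∘ (outside ∷_)) (subsets n) + count (P? ∘ (inside ∷_)) (subsets n)
count-subsets-suc n P? = trans (count-++ P? (map (outside ∷_) (subsets n)) _)
  (cong₂ _+_ (count-map P? (outside ∷_) (subsets n)) (count-map P? (inside ∷_) (subsets n)))

count-emptyᵇ : ∀ n → count (T? ∘ emptyᵇ) (subsets n) ≡ 1
count-emptyᵇ zero    = refl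
count-emptyᵇ (suc n) = trans (count-subsets-suc n (T? ∘ emptyᵇ))
  (cong₂ _+_ (count-emptyᵇ n) (count-none (T? ∘ emptyᵇ ∘ (inside ∷_)) (subsets n) (All.tabulate λ _ ())))

count-initialᵇ : ∀ n → count (T? ∘ initialᵇ) (subsets n) ≡ suc n
count-initialᵇ zero    = refl
count-initialᵇ (suc n) =
  trans (count-subsets-suc n (T? ∘ initialᵇ)) (cong₂ _+_ (count-emptyᵇ n) (count-initialᵇ n))

count-intervalᵇ : ∀ n → count (T? ∘ intervalᵇ) (subsets n) ≡ suc (tri n)
count-intervalᵇ zero    = refl
count-intervalᵇ (suc n) = trans (count-subsets-suc n (T? ∘ intervalᵇ))
  (trans (cong₂ _+_ (count-intervalᵇ n) (count-initialᵇ n)) (cong suc (sym (tri-suc n))))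

count-isInterval : ∀ n → count isInterval? (subsets n) ≡ suc (tri n)
count-isInterval n = trans
  (count-cong isInterval? (T? ∘ intervalᵇ) ((λ {S} → intervalᵇ-complete S) , (λ {S} → intervalᵇ-sound S)) (subsets n))
  (count-intervalᵇ n)

⊆-antichain⇒≡ : ∀ {n} {xs : List (Subset n)} → AllPairs (λ I J → ¬ I ⊆ J × ¬ J ⊆ I) xs →
  ∀ {I J} → I ∈ xs → J ∈ xs → I ⊆ J → I ≡ J
⊆-antichain⇒≡ (_   ∷ _)   (here refl) (here refl) _   = refl
⊆-antichain⇒≡ (I#  ∷ _)   (here refl) (there J∈)  I⊆J = ⊥-elim (proj₁ (All.lookup I# J∈) I⊆J)
⊆-antichain⇒≡ (J#  ∷ _)   (there I∈)  (here refl) I⊆J = ⊥-elim (proj₂ (All.lookup J# I∈) I⊆J)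
⊆-antichain⇒≡ (_   ∷ ac)  (there I∈)  (there J∈)  I⊆J = ⊆-antichain⇒≡ ac I∈ J∈ I⊆J

module AntichainLattice (n : ℕ) where

  Up : Antichain n → Pred (Subset n) 0ℓ
  Up A I = IsInterval I × Any (_⊆ I) (elems A)

  Up? : (A : Antichain n) → Decidable (Up A)
  Up? A I = isInterval? I ×-dec any? (_⊆? I) (elems A)

  ρ : Antichain n → ℕ
  ρ A = count (Up? A) (subsets n)

  ≈⇒≼ : (A B : Antichain n) → A ≈ B → A ≼ B
  ≈⇒≼ _ _ A≈B I I∈A = I , proj₁ (A≈B I) I∈A , ⊆-refl

  ≈-sym : (A B : Antichain n) → A ≈ B → B ≈ A
  ≈-sym _ _ A≈B I = proj₂ (A≈B I) , proj₁ (A≈B I)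

  ≼-trans : (A B C : Antichain n) → A ≼ B → B ≼ C → A ≼ C
  ≼-trans _ _ _ A≼B B≼C I I∈A with A≼B I I∈A
  ... | J , J∈B , J⊆I with B≼C J J∈B
  ...   | K , K∈C , K⊆J = K , K∈C , ⊆-trans K⊆J J⊆I

  Up-upward : (A : Antichain n) {I J : Subset n} → Up A J → J ⊆ I → IsInterval I → Up A I
  Up-upward _ (_ , ∃K⊆J) J⊆I I-interval =
    let K , K∈A , K⊆J = find ∃K⊆J in I-interval , lose K∈A (⊆-trans K⊆J J⊆I)

  ∈⇒Up : (A : Antichain n) {J : Subset n} → J ∈ elems A → Up A J
  ∈⇒Up A J∈A = All.lookup (intervals A) J∈A , lose J∈A ⊆-refl

  Up-mono : (A B : Antichain n) → A ≼ B → ∀ {I} → Up A I → Up B I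
  Up-mono _ _ A≼B (I-interval , ∃J⊆I) with find ∃J⊆I
  ... | J , J∈A , J⊆I with A≼B J J∈A
  ...   | K , K∈B , K⊆J = I-interval , lose K∈B (⊆-trans K⊆J J⊆I)

  Up⊆⇒≈ : (A B : Antichain n) → A ≼ B → (∀ {I} → Up B I → Up A I) → A ≈ B
  Up⊆⇒≈ A B A≼B B⊆A J = A⇒B , B⇒A
    where
    squeeze : ∀ {xs : List (Subset n)} → AllPairs (λ I J → ¬ I ⊆ J × ¬ J ⊆ I) xs →
      ∀ {K L} → J ∈ xs → L ∈ xs → L ⊆ K → K ⊆ J → K ≡ J
    squeeze ac J∈ L∈ L⊆K K⊆J with ⊆-antichain⇒≡ ac L∈ J∈ (⊆-trans L⊆K K⊆J)
    ... | refl = ⊆-antisym K⊆J L⊆K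
    A⇒B : J ∈ elems A → J ∈ elems B
    A⇒B J∈A with A≼B J J∈A
    ... | K , K∈B , K⊆J with find (proj₂ (B⊆A (∈⇒Up B K∈B)))
    ...   | L , L∈A , L⊆K = subst (_∈ elems B) (squeeze (antichain A) J∈A L∈A L⊆K K⊆J) K∈B
    B⇒A : J ∈ elems B → J ∈ elems A
    B⇒A J∈B with find (proj₂ (B⊆A (∈⇒Up B J∈B)))
    ... | L , L∈A , L⊆J with A≼B L L∈A
    ...   | K , K∈B , K⊆L = subst (_∈ elems A) (squeeze (antichain B) J∈B K∈B K⊆L L⊆J) L∈A

  ∃-Up-new : (A B : Antichain n) → A ≼ B → ¬ A ≈ B → ∃ λ I → Up B I × ¬ Up A I
  ∃-Up-new A B A≼B A≉B with any? (λ I → Up? B I ×-dec ¬? (Up? A I)) (subsets n)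
  ... | yes new = let I , _ , newI = find new in I , newI
  ... | no ¬new = contradiction (Up⊆⇒≈ A B A≼B B⊆A) A≉B
    where
    B⊆A : ∀ {I} → Up B I → Up A I
    B⊆A {I} BI = decidable-stable (Up? A I) λ ¬AI → ¬new (lose (∈-subsets I) (BI , ¬AI))

  ρ-mono : (A B : Antichain n) → A ≼ B → ρ A ≤ ρ B
  ρ-mono A B A≼B = count-mono (Up? A) (Up? B) {xs = subsets n} λ _ → Up-mono A B A≼B

  ρ-≺ : (A B : Antichain n) → A ≺ B → ρ A < ρ B
  ρ-≺ A B (A≼B , A≉B) =
    let I , BI , ¬AI = ∃-Up-new A B A≼B A≉B
    in count-mono-< (Up? A) (Up? B) {xs = subsets n} (λ _ → Up-mono A B A≼B) (∈-subsets I) BI ¬AI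

  ≈⇒ρ≡ : (A B : Antichain n) → A ≈ B → ρ A ≡ ρ B
  ≈⇒ρ≡ A B A≈B = ≤-antisym (ρ-mono A B (≈⇒≼ A B A≈B)) (ρ-mono B A (≈⇒≼ B A (≈-sym A B A≈B)))

  ρ≢⇒≉ : (A B : Antichain n) → ρ A ≢ ρ B → ¬ A ≈ B
  ρ≢⇒≉ A B ρA≢ρB = ρA≢ρB ∘ ≈⇒ρ≡ A B

  ≺-trans : (A B C : Antichain n) → A ≺ B → B ≺ C → A ≺ C
  ≺-trans A B C A≺B B≺C =
    ≼-trans A B C (proj₁ A≺B) (proj₁ B≺C) , ρ≢⇒≉ A C (<⇒≢ (<-trans (ρ-≺ A B A≺B) (ρ-≺ B C B≺C)))

  module Adjoin (y : Antichain n) {m : Subset n} (m-interval : IsInterval m)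
                (m-new : ¬ Any (_⊆ m) (elems y)) where

    kept : List (Subset n)
    kept = filter (λ J → ¬? (m ⊆? J)) (elems y)

    adjoined : Antichain n
    adjoined = mkAntichain (m ∷ kept)
      (m-interval ∷ All.filter⁺ _ (intervals y))
      (incomparable ∷ AllPairs.filter⁺ _ (antichain y))
      where
      incomparable : All (λ J → ¬ m ⊆ J × ¬ J ⊆ m) kept
      incomparable = All.tabulate λ J∈kept →
        let J∈y , m⊈J = ∈-filter⁻ _ J∈kept in m⊈J , λ J⊆m → m-new (lose J∈y J⊆m)

    y≺adjoined : y ≺ adjoined
    y≺adjoined = y≼adjoined , λ y≈adjoined → m-new (lose (proj₂ (y≈adjoined m) (here refl)) ⊆-refl)
      where
      y≼adjoined : y ≼ adjoined
      y≼adjoined J J∈y with m ⊆? J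
      ... | yes m⊆J = m , here refl , m⊆J
      ... | no  m⊈J = J , there (∈-filter⁺ _ J∈y m⊈J) , ⊆-refl

    adjoined-≼ : (x : Antichain n) → Up x m → y ≼ x → adjoined ≼ x
    adjoined-≼ x (_ , ∃K⊆m) _   _ (here refl)  = find ∃K⊆m
    adjoined-≼ x _          y≼x J (there J∈kept) = y≼x J (proj₁ (∈-filter⁻ _ J∈kept))

    Up-adjoined : ∀ {I} → Up adjoined I → Up y I ⊎ m ⊆ I
    Up-adjoined (_          , here m⊆I)    = inj₂ m⊆I
    Up-adjoined (I-interval , there ∃J⊆I) =
      let J , J∈kept , J⊆I = find ∃J⊆I in inj₁ (I-interval , lose (proj₁ (∈-filter⁻ _ J∈kept)) J⊆I)

    ρ-adjoined-≤ : (∀ {I} → IsInterval I → m ⊂ I → Up y I) → ρ adjoined ≤ suc (ρ y)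
    ρ-adjoined-≤ above-m = count-≤-suc (Up? adjoined) (Up? y) (subsets-unique n) λ _ → old-or-m
      where
      old-or-m : ∀ {I} → Up adjoined I → Up y I ⊎ I ≡ m
      old-or-m {I} adjoined-I with Up-adjoined adjoined-I
      ... | inj₁ y-I = inj₁ y-I
      ... | inj₂ m⊆I with m ⊂? I
      ...   | yes m⊂I = inj₁ (above-m (proj₁ adjoined-I) m⊂I)
      ...   | no  m⊄I = inj₂ (⊆-antisym (⊆∧⊄⇒⊇ m⊆I m⊄I) m⊆I)

  ρ-intermediate : (x y : Antichain n) → y ≼ x → 2 + ρ y ≤ ρ x →
    ∃ λ z → y ≺ z × z ≺ x × ρ z ≡ suc (ρ y)
  -- m is an inclusion-maximal interval of Up x ∖ Up y, so every interval
  -- strictly above m already lies in Up y: adjoining m adds m alone.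
  ρ-intermediate x y y≼x gap
    with I₀ , new₀ ← ∃-Up-new y x y≼x (ρ≢⇒≉ y x (<⇒≢ (<-trans (n<1+n _) gap)))
    with m , (x-m , ¬y-m) , m-maximal ← ∃-⊂-maximal (λ I → Up? x I ×-dec ¬? (Up? y I)) new₀
    = adjoined , y≺adjoined , (adjoined-≼ x x-m y≼x , ρ≢⇒≉ adjoined x (<⇒≢ ρz<ρx)) , ρz
    where
    open Adjoin y (proj₁ x-m) (λ ∃J⊆m → ¬y-m (proj₁ x-m , ∃J⊆m))
    above-m : ∀ {I} → IsInterval I → m ⊂ I → Up y I
    above-m {I} I-interval m⊂I = decidable-stable (Up? y I) λ ¬y-I →
      m-maximal m⊂I (Up-upward x x-m (proj₁ m⊂I) I-interval , ¬y-I)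
    ρz : ρ adjoined ≡ suc (ρ y)
    ρz = ≤-antisym (ρ-adjoined-≤ above-m) (ρ-≺ y adjoined y≺adjoined)
    ρz<ρx : ρ adjoined < ρ x
    ρz<ρx = subst (_< ρ x) (sym ρz) gap

  covers⇒ρ≡ : (x y : Antichain n) → Covers x y → ρ x ≡ suc (ρ y)
  covers⇒ρ≡ x y (y≺x , nothing-between) = ≤-antisym (≮⇒≥ no-gap) (ρ-≺ y x y≺x)
    where
    no-gap : ¬ suc (ρ y) < ρ x
    no-gap gap =
      let z , y≺z , z≺x , _ = ρ-intermediate x y (proj₁ y≺x) gap in nothing-between z (y≺z , z≺x)

  ρ≡⇒covers : (x y : Antichain n) → y ≺ x → ρ x ≡ suc (ρ y) → Covers x y
  ρ≡⇒covers x y y≺x ρx≡ = y≺x , λ z (y≺z , z≺x) →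
    <⇒≱ (ρ-≺ y z y≺z) (≤-pred (≤-trans (ρ-≺ z x z≺x) (≤-reflexive ρx≡)))

  ρ-bot : ρ (bot n) ≡ 0
  ρ-bot = count-none (Up? (bot n)) (subsets n) (All.tabulate λ _ ())

  ρ-isRank : IsRank ρ
  ρ-isRank = ρ-bot , covers⇒ρ≡

  ρ-top : ρ (top n) ≡ suc (tri n)
  ρ-top = trans
    (count-cong (Up? (top n)) isInterval? (proj₁ , λ {I} I-interval → I-interval , here (⊆-min I)) (subsets n))
    (count-isInterval n)

  data SaturatedChain (y : Antichain n) : Antichain n → ℕ → Set where
    [_] : ∀ {x} → Covers x y → SaturatedChain y x 1
    _∷_ : ∀ {z x k} → Covers z y → SaturatedChain z x k → SaturatedChain y x (suc k)

  saturatedChain : ∀ d (x y : Antichain n) → y ≺ x → ρ x ≡ suc d + ρ y →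
                   SaturatedChain y x (suc d)
  saturatedChain zero    x y y≺x ρx≡ = [ ρ≡⇒covers x y y≺x ρx≡ ]
  saturatedChain (suc d) x y y≺x ρx≡ = extend (ρ-intermediate x y (proj₁ y≺x) gap)
    where
    gap : 2 + ρ y ≤ ρ x
    gap = subst (2 + ρ y ≤_) (sym ρx≡) (s≤s (s≤s (m≤n+m (ρ y) d)))
    extend : (∃ λ z → y ≺ z × z ≺ x × ρ z ≡ suc (ρ y)) → SaturatedChain y x (suc (suc d))
    extend (z , y≺z , z≺x , ρz≡) = ρ≡⇒covers z y y≺z ρz≡ ∷ saturatedChain d x z z≺x
      (trans ρx≡ (trans (sym (+-suc (suc d) (ρ y))) (cong (suc d +_) (sym ρz≡))))

  rank-along : (r : Antichain n → ℕ) → IsRank r → ∀ {y x k} → SaturatedChain y x k → r x ≡ k + r y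
  rank-along r r-rank {y} {x} [ x⋗y ] = proj₂ r-rank x y x⋗y
  rank-along r r-rank {y} {x} (_∷_ {z} {k = k} z⋗y chain) =
    trans (rank-along r r-rank chain) (trans (cong (k +_) (proj₂ r-rank z y z⋗y)) (+-suc k (r y)))

  members : ∀ {y x k} → SaturatedChain y x k → List (Antichain n)
  members {x = x} [ _ ]        = x ∷ []
  members (_∷_ {z} _ chain)    = z ∷ members chain

  length-members : ∀ {y x k} (chain : SaturatedChain y x k) → length (members chain) ≡ k
  length-members [ _ ]         = refl
  length-members (_ ∷ chain)   = cong suc (length-members chain)

  members-≺ : ∀ {y x k} (chain : SaturatedChain y x k) → AllPairs _≺_ (y ∷ members chain)
  members-≺ [ x⋗y ] = (proj₁ x⋗y ∷ []) ∷ [] ∷ []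
  members-≺ {y} (_∷_ {z} z⋗y chain) with members-≺ chain
  ... | z≺members ∷ ≺-members =
    (proj₁ z⋗y ∷ All.map (λ {w} → ≺-trans y z w (proj₁ z⋗y)) z≺members) ∷ z≺members ∷ ≺-members

  ≼-top : (A : Antichain n) → A ≼ top n
  ≼-top _ J _ = ∅ , here refl , ⊆-min J

  ρ<2+tri : (A : Antichain n) → ρ A < 2 + tri n
  ρ<2+tri A = s≤s (subst (ρ A ≤_) ρ-top (ρ-mono A (top n) (≼-top A)))

  comparable⇒ρ≢ : (A B : Antichain n) → ¬ A ≈ B × (A ≼ B ⊎ B ≼ A) → ρ A ≢ ρ B
  comparable⇒ρ≢ A B (A≉B , inj₁ A≼B) = <⇒≢ (ρ-≺ A B (A≼B , A≉B))
  comparable⇒ρ≢ A B (A≉B , inj₂ B≼A) = >⇒≢ (ρ-≺ B A (B≼A , A≉B ∘ ≈-sym B A))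

  chain-length-≤ : (c : List (Antichain n)) → IsChain c → length c ≤ 2 + tri n
  chain-length-≤ c c-chain = subst (_≤ 2 + tri n) (length-map ρ c)
    (unique-<⇒length≤ (2 + tri n) (AllPairs.map⁺ (AllPairs.map (λ {A} {B} → comparable⇒ρ≢ A B) c-chain))
                                  (All.map⁺ (All.tabulate λ {A} _ → ρ<2+tri A)))

  bot≺top : bot n ≺ top n
  bot≺top = (λ _ ()) , λ bot≈top → ∅∉[] (proj₂ (bot≈top ∅) (here refl))
    where
    ∅∉[] : ¬ ∅ ∈ []
    ∅∉[] ()

  bot-top-chain : SaturatedChain (bot n) (top n) (suc (tri n))
  bot-top-chain = saturatedChain (tri n) (top n) (bot n) bot≺top (begin
    ρ (top n)                ≡⟨ ρ-top ⟩
    suc (tri n)              ≡⟨ +-identityʳ (suc (tri n)) ⟨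
    suc (tri n) + 0          ≡⟨ cong (suc (tri n) +_) ρ-bot ⟨
    suc (tri n) + ρ (bot n)  ∎)
    where open ≡-Reasoning

  rank-top : (r : Antichain n → ℕ) → IsRank r → r (top n) ≡ 1 + tri n
  rank-top r r-rank = begin
    r (top n)                ≡⟨ rank-along r r-rank bot-top-chain ⟩
    suc (tri n) + r (bot n)  ≡⟨ cong (suc (tri n) +_) (proj₁ r-rank) ⟩
    suc (tri n) + 0          ≡⟨ +-identityʳ (suc (tri n)) ⟩
    1 + tri n                ∎
    where open ≡-Reasoning

  ≺-chain⇒IsChain : {c : List (Antichain n)} → AllPairs _≺_ c → IsChain c
  ≺-chain⇒IsChain = AllPairs.map λ A≺B → proj₂ A≺B , inj₁ (proj₁ A≺B)

corollary28 : (n : ℕ)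
    → ((Σ (Antichain n → ℕ) λ r → IsRank r × r (top n) ≡ 1 + tri n)
    × (∀ (r : Antichain n → ℕ) → IsRank r → r (top n) ≡ 1 + tri n))
    × HasHeight n (2 + tri n)
corollary28 n =
  ((ρ , ρ-isRank , ρ-top) , rank-top) ,
  (bot n ∷ members bot-top-chain , ≺-chain⇒IsChain (members-≺ bot-top-chain) , cong suc (length-members bot-top-chain)) ,
  chain-length-≤
  where open AntichainLattice n
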